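{- Let $C_1$ be the real $3\times3$ matrix $\begin{pmatrix}0&0&0\\0&1&2\\0&2&1\end{pmatrix}$ and for $n\ge2$ let $C_n$ be the $3^n\times3^n$ block matrix $\begin{pmatrix}C_{n-1}&C_{n-1}&C_{n-1}\\ C_{n-1}&C_{n-1}\oplus\mathbf 1&C_{n-1}\oplus\mathbf 2\\ C_{n-1}&C_{n-1}\oplus\mathbf 2&C_{n-1}\oplus\mathbf 1\end{pmatrix}$, where $M\oplus\mathbf c$ denotes the matrix obtained by replacing each entry $m$ of $M$ by $(m+c)\bmod 3\in\{0,1,2\}$. Then for every $n\ge1$, the rank of $C_n$ over $\mathbb{R}$ is $3^n-1$; i.e., the functions $\{0,1,2\}^n\to\mathbb{R}$, $(x_1,\dots,x_n)\mapsto(a_1\odot x_1)\oplus\dots\oplus(a_n\odot x_n)$ for $(a_1,\dots,a_n)\in\{0,1,2\}^n\setminus\{(0,\dots,0)\}$ are linearly independent over $\mathbb{R}$.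
   Context: $\oplus$ and $\odot$ denote addition and multiplication modulo 3, with values in $\{0,1,2\}$ regarded as real numbers. The columns of $C_n$ are the value vectors of the functions $(a_1\odot x_1)\oplus\dots\oplus(a_n\odot x_n)$, $(a_1,\dots,a_n)\in\{0,1,2\}^n$, on the points of $\{0,1,2\}^n$.
   Formalization: The rank of $C_n$ and the linear independence of the functions are taken over ℚ instead of over ℝ. -}

module Defs where

open import Data.Nat using (ℕ; zero; suc; _+_; _*_)
open import Data.Nat.DivMod using (_%_)
open import Data.Fin using (Fin; toℕ)
open import Data.Vec using (Vec; []; _∷_; replicate)
open import Data.List using (List; []; _∷_; map; concatMap; foldr)
open import Data.Integer using (+_)
open import Data.Rational using (ℚ; _/_; 0ℚ) renaming (_+_ to _+ℚ_; _*_ to _*ℚ_)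
import Data.Fin as Fin
import Data.Vec as V

_⊕_ : ℕ → ℕ → ℕ
m ⊕ c = (m + c) % 3

_⊙_ : ℕ → ℕ → ℕ
a ⊙ x = (a * x) % 3

-- C n x a : entry of C_n in row x, column a (indices in {0,1,2}^n, the
-- first coordinate being the block index). C_0 is the 1×1 zero matrix, so that
-- C_1 = [[0,0,0],[0,1,2],[0,2,1]] and C_(n+1) has blocks C_n ⊕ (x₁ ⊙ a₁),
-- exactly the block recursion of the paper.
C : (n : ℕ) → Vec (Fin 3) n → Vec (Fin 3) n → ℕ
C zero [] [] = 0
C (suc n) (x ∷ xs) (a ∷ as) = C n xs as ⊕ (toℕ a ⊙ toℕ x)

allVecs : (n : ℕ) → List (Vec (Fin 3) n)
allVecs zero = [] ∷ []
allVecs (suc n) = concatMap (λ v → (Fin.zero V.∷ v) ∷ (Fin.suc Fin.zero V.∷ v) ∷ (Fin.suc (Fin.suc Fin.zero) V.∷ v) ∷ []) (allVecs n)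

zeroVec : (n : ℕ) → Vec (Fin 3) n
zeroVec n = replicate n Fin.zero

toℚ : ℕ → ℚ
toℚ k = + k / 1

sumℚ : List ℚ → ℚ
sumℚ = foldr _+ℚ_ 0ℚ

{-# OPTIONS --safe #-}
-- Fix b ≠ 0 and pair the vanishing combination with x ↦ ω (b ∙ x), where ω = (1, 1, -2) has
-- zero sum. As x ranges over 𝔽₃ⁿ, the pair (b ∙ x, a ∙ x) is uniformly distributed on 𝔽₃²
-- when a is not a multiple of b, and equals (t, l t) with t uniform when a = l b. Since ω has
-- zero sum only multiples of b contribute, and among them only a = b, because
-- Σₜ ω t · t = -3 whereas Σₜ ω t · 0 = Σₜ ω t · (2 t mod 3) = 0. Hence the pairing equals
-- -3ⁿ · c b, so c b = 0. Both distribution facts are proved by induction on n.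
module Submission where

open import Defs
open import Data.Empty using (⊥-elim)
open import Data.Fin using (Fin; toℕ; _≟_)
open import Data.Fin.Patterns using (0F; 1F; 2F)
open import Data.Fin.Properties using (all?; any?; toℕ-fromℕ<)
open import Data.List using ([]; _∷_; map; concatMap)
open import Data.Nat using (ℕ; zero; suc; _≥_)
import Data.Nat as ℕ
open import Data.Nat.DivMod using (_mod_)
open import Data.Product using (_,_)
open import Data.Rational using (ℚ; 0ℚ; 1ℚ; _+_; _*_; -_; 1/_)
open import Data.Rational.Base using (≢-nonZero; +-*-rawSemiring)
open import Algebra.Definitions.RawSemiring +-*-rawSemiring using (_^_)
open import Data.Rational.Properties
  using (+-identityˡ; +-identityʳ; +-assoc; +-comm; *-identityˡ; *-zeroʳ; *-assoc; *-comm; *-inverseˡ)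
  renaming (_≟_ to _≟ℚ_)
open import Data.Rational.Solver using (module +-*-Solver)
open import Data.Vec using (Vec; []; _∷_)
import Data.Vec as Vec
open import Data.Vec.Properties using (∷-injectiveˡ; ∷-injectiveʳ)
  renaming (≡-dec to ≡-decᵥ)
open import Function using (_∘_)
open import Relation.Binary.PropositionalEquality
  using (_≡_; _≢_; refl; sym; trans; cong; cong₂; module ≡-Reasoning)
open import Relation.Nullary using (yes; no; ¬?)
open import Relation.Nullary.Decidable using (from-yes; _→-dec_)

open +-*-Solver using (solve; _:+_; _:*_; _:=_; con)
open ≡-Reasoning

infixl 6 _+₃_
infixl 7 _·₃_
infix  8 -₃_

_+₃_ : Fin 3 → Fin 3 → Fin 3
a +₃ b = (toℕ a ℕ.+ toℕ b) mod 3

_·₃_ : Fin 3 → Fin 3 → Fin 3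
a ·₃ b = (toℕ a ℕ.* toℕ b) mod 3

-₃_ : Fin 3 → Fin 3
-₃ a = (3 ℕ.∸ toℕ a) mod 3

toℕ-+₃ : ∀ a b → toℕ (a +₃ b) ≡ toℕ a ⊕ toℕ b
toℕ-+₃ a b = toℕ-fromℕ< _

toℕ-·₃ : ∀ a b → toℕ (a ·₃ b) ≡ toℕ a ⊙ toℕ b
toℕ-·₃ a b = toℕ-fromℕ< _

+₃-identityˡ : ∀ a → 0F +₃ a ≡ a
+₃-identityˡ = from-yes (all? λ a → 0F +₃ a ≟ a)

s-e+e≡s : ∀ s e → s +₃ -₃ e +₃ e ≡ s
s-e+e≡s = from-yes (all? λ s → all? λ e → s +₃ -₃ e +₃ e ≟ s)

a≢b⇒a-b≢0 : ∀ a b → a ≢ b → a +₃ -₃ b ≢ 0F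
a≢b⇒a-b≢0 = from-yes (all? λ a → all? λ b → ¬? (a ≟ b) →-dec ¬? (a +₃ -₃ b ≟ 0F))

·₃-identityˡ : ∀ a → 1F ·₃ a ≡ a
·₃-identityˡ = from-yes (all? λ a → 1F ·₃ a ≟ a)

·₃-zeroʳ : ∀ a → a ·₃ 0F ≡ 0F
·₃-zeroʳ = from-yes (all? λ a → a ·₃ 0F ≟ 0F)

a·b·b≡a : ∀ a b → b ≢ 0F → a ·₃ b ·₃ b ≡ a
a·b·b≡a = from-yes (all? λ a → all? λ b → ¬? (b ≟ 0F) →-dec (a ·₃ b ·₃ b ≟ a))

·₃-distrib-+₃ : ∀ l d b x → l ·₃ (d +₃ b ·₃ x) ≡ l ·₃ d +₃ l ·₃ b ·₃ x
·₃-distrib-+₃ = from-yes (all? λ l → all? λ d → all? λ b → all? λ x →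
  l ·₃ (d +₃ b ·₃ x) ≟ l ·₃ d +₃ l ·₃ b ·₃ x)

shear-identity : ∀ l s b k a → l ·₃ (s +₃ -₃ (b ·₃ k)) +₃ a ·₃ k ≡ (a +₃ -₃ (l ·₃ b)) ·₃ k +₃ l ·₃ s
shear-identity = from-yes (all? λ l → all? λ s → all? λ b → all? λ k → all? λ a →
  l ·₃ (s +₃ -₃ (b ·₃ k)) +₃ a ·₃ k ≟ (a +₃ -₃ (l ·₃ b)) ·₃ k +₃ l ·₃ s)

infix 8 _∙_ _•_

-- The head coordinate is added last, as in the block recursion of C.
_∙_ : ∀ {n} → Vec (Fin 3) n → Vec (Fin 3) n → Fin 3
[]       ∙ []       = 0F
(a ∷ as) ∙ (x ∷ xs) = as ∙ xs +₃ a ·₃ x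

_•_ : ∀ {n} → Fin 3 → Vec (Fin 3) n → Vec (Fin 3) n
l • b = Vec.map (l ·₃_) b

C≡toℕ-∙ : ∀ n x a → C n x a ≡ toℕ (a ∙ x)
C≡toℕ-∙ zero    []       []       = refl
C≡toℕ-∙ (suc n) (x ∷ xs) (a ∷ as) = begin
  C n xs as ⊕ (toℕ a ⊙ toℕ x)        ≡⟨ cong₂ _⊕_ (C≡toℕ-∙ n xs as) (sym (toℕ-·₃ a x)) ⟩
  toℕ (as ∙ xs) ⊕ toℕ (a ·₃ x)       ≡⟨ sym (toℕ-+₃ (as ∙ xs) (a ·₃ x)) ⟩
  toℕ (as ∙ xs +₃ a ·₃ x)            ∎

∙-zeroˡ : ∀ {n} (x : Vec (Fin 3) n) → zeroVec n ∙ x ≡ 0F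
∙-zeroˡ []       = refl
∙-zeroˡ (x ∷ xs) = cong (_+₃ 0F) (∙-zeroˡ xs)

∙-•ˡ : ∀ {n} l (b x : Vec (Fin 3) n) → (l • b) ∙ x ≡ l ·₃ (b ∙ x)
∙-•ˡ l []       []       = sym (·₃-zeroʳ l)
∙-•ˡ l (b ∷ bs) (x ∷ xs) = begin
  (l • bs) ∙ xs +₃ l ·₃ b ·₃ x   ≡⟨ cong (_+₃ l ·₃ b ·₃ x) (∙-•ˡ l bs xs) ⟩
  l ·₃ (bs ∙ xs) +₃ l ·₃ b ·₃ x  ≡⟨ sym (·₃-distrib-+₃ l (bs ∙ xs) b x) ⟩
  l ·₃ (bs ∙ xs +₃ b ·₃ x)       ∎

zeroVec∙x+c≡c : ∀ {n} (x : Vec (Fin 3) n) c → zeroVec n ∙ x +₃ c ≡ c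
zeroVec∙x+c≡c x c = trans (cong (_+₃ c) (∙-zeroˡ x)) (+₃-identityˡ c)

•-identityˡ : ∀ {n} (b : Vec (Fin 3) n) → 1F • b ≡ b
•-identityˡ []       = refl
•-identityˡ (b ∷ bs) = cong₂ _∷_ (·₃-identityˡ b) (•-identityˡ bs)

•-zeroʳ : ∀ n l → l • zeroVec n ≡ zeroVec n
•-zeroʳ zero    l = refl
•-zeroʳ (suc n) l = cong₂ _∷_ (·₃-zeroʳ l) (•-zeroʳ n l)

sum₃ : (Fin 3 → ℚ) → ℚ
sum₃ f = f 0F + (f 1F + f 2F)

sum₃-cong : ∀ {f g} → (∀ k → f k ≡ g k) → sum₃ f ≡ sum₃ g
sum₃-cong f≗g = cong₂ _+_ (f≗g 0F) (cong₂ _+_ (f≗g 1F) (f≗g 2F))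

sum₃-+ : ∀ f g → sum₃ (λ k → f k + g k) ≡ sum₃ f + sum₃ g
sum₃-+ f g = solve 6
  (λ a b c a′ b′ c′ → (a :+ a′) :+ ((b :+ b′) :+ (c :+ c′)) := (a :+ (b :+ c)) :+ (a′ :+ (b′ :+ c′)))
  refl (f 0F) (f 1F) (f 2F) (g 0F) (g 1F) (g 2F)

sum₃-*ˡ : ∀ p f → sum₃ (λ k → p * f k) ≡ p * sum₃ f
sum₃-*ˡ p f = solve 4 (λ p a b c → p :* a :+ (p :* b :+ p :* c) := p :* (a :+ (b :+ c)))
  refl p (f 0F) (f 1F) (f 2F)

sum₃-const : ∀ p → sum₃ (λ _ → p) ≡ toℚ 3 * p
sum₃-const = solve 1 (λ p → p :+ (p :+ p) := con (toℚ 3) :* p) refl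

sum₃-comm : ∀ (f : Fin 3 → Fin 3 → ℚ) → sum₃ (λ i → sum₃ (f i)) ≡ sum₃ (λ j → sum₃ (λ i → f i j))
sum₃-comm f = solve 9
  (λ a b c d e g h i j → (a :+ (b :+ c)) :+ ((d :+ (e :+ g)) :+ (h :+ (i :+ j)))
                      := (a :+ (d :+ h)) :+ ((b :+ (e :+ i)) :+ (c :+ (g :+ j))))
  refl (f 0F 0F) (f 0F 1F) (f 0F 2F) (f 1F 0F) (f 1F 1F) (f 1F 2F) (f 2F 0F) (f 2F 1F) (f 2F 2F)

sum₃-scaled : ∀ p q (f g : Fin 3 → ℚ) → (∀ k → p * f k ≡ q * g k) → p * sum₃ f ≡ q * sum₃ g
sum₃-scaled p q f g eq = begin
  p * sum₃ f               ≡⟨ sym (sum₃-*ˡ p f) ⟩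
  sum₃ (λ k → p * f k)     ≡⟨ sum₃-cong eq ⟩
  sum₃ (λ k → q * g k)     ≡⟨ sum₃-*ˡ q g ⟩
  q * sum₃ g               ∎

+-rotate : ∀ x y z → y + (z + x) ≡ x + (y + z)
+-rotate x y z = trans (sym (+-assoc y z x)) (+-comm (y + z) x)

sum₃-translate : ∀ d f → sum₃ (λ t → f (t +₃ d)) ≡ sum₃ f
sum₃-translate 0F f = refl
sum₃-translate 1F f = +-rotate (f 0F) (f 1F) (f 2F)
sum₃-translate 2F f = trans (+-rotate (f 1F) (f 2F) (f 0F)) (+-rotate (f 0F) (f 1F) (f 2F))

sum₃-scale : ∀ {c} f → c ≢ 0F → sum₃ (λ t → f (c ·₃ t)) ≡ sum₃ f
sum₃-scale {0F} f c≢0 = ⊥-elim (c≢0 refl)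
sum₃-scale {1F} f _   = refl
sum₃-scale {2F} f _   = cong (f 0F +_) (+-comm (f 2F) (f 1F))

sum₃-affine : ∀ {c} d f → c ≢ 0F → sum₃ (λ t → f (c ·₃ t +₃ d)) ≡ sum₃ f
sum₃-affine d f c≢0 = trans (sum₃-scale (λ u → f (u +₃ d)) c≢0) (sum₃-translate d f)

sum₃-single : ∀ j f → (∀ k → k ≢ j → f k ≡ 0ℚ) → sum₃ f ≡ f j
sum₃-single 0F f f≡0 = begin
  f 0F + (f 1F + f 2F)  ≡⟨ cong₂ (λ u v → f 0F + (u + v)) (f≡0 1F λ ()) (f≡0 2F λ ()) ⟩
  f 0F + (0ℚ + 0ℚ)      ≡⟨ +-identityʳ (f 0F) ⟩
  f 0F                  ∎
sum₃-single 1F f f≡0 = begin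
  f 0F + (f 1F + f 2F)  ≡⟨ cong₂ (λ u v → u + (f 1F + v)) (f≡0 0F λ ()) (f≡0 2F λ ()) ⟩
  0ℚ + (f 1F + 0ℚ)      ≡⟨ trans (+-identityˡ _) (+-identityʳ (f 1F)) ⟩
  f 1F                  ∎
sum₃-single 2F f f≡0 = begin
  f 0F + (f 1F + f 2F)  ≡⟨ cong₂ (λ u v → u + (v + f 2F)) (f≡0 0F λ ()) (f≡0 1F λ ()) ⟩
  0ℚ + (0ℚ + f 2F)      ≡⟨ trans (+-identityˡ _) (+-identityˡ (f 2F)) ⟩
  f 2F                  ∎

-- Substituting t := s - b k turns the summand into H s (c k + l s) with c = a - l b ≠ 0,
-- so the inner sum over k runs through every value of the second argument.
sum₃-shear : ∀ l a b (H : Fin 3 → Fin 3 → ℚ) → a ≢ l ·₃ b →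
  sum₃ (λ k → sum₃ (λ t → H (t +₃ b ·₃ k) (l ·₃ t +₃ a ·₃ k))) ≡ sum₃ (λ s → sum₃ (H s))
sum₃-shear l a b H a≢lb = begin
  sum₃ (λ k → sum₃ (λ t → H (t +₃ b ·₃ k) (l ·₃ t +₃ a ·₃ k)))
    ≡⟨ sum₃-cong (λ k → sym (sum₃-translate (-₃ (b ·₃ k)) (λ t → H (t +₃ b ·₃ k) (l ·₃ t +₃ a ·₃ k)))) ⟩
  sum₃ (λ k → sum₃ (λ s → H (s +₃ -₃ (b ·₃ k) +₃ b ·₃ k) (l ·₃ (s +₃ -₃ (b ·₃ k)) +₃ a ·₃ k)))
    ≡⟨ sum₃-cong (λ k → sum₃-cong (λ s →
         cong₂ H (s-e+e≡s s (b ·₃ k)) (shear-identity l s b k a))) ⟩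
  sum₃ (λ k → sum₃ (λ s → H s (c ·₃ k +₃ l ·₃ s)))
    ≡⟨ sum₃-comm (λ k s → H s (c ·₃ k +₃ l ·₃ s)) ⟩
  sum₃ (λ s → sum₃ (λ k → H s (c ·₃ k +₃ l ·₃ s)))
    ≡⟨ sum₃-cong (λ s → sum₃-affine (l ·₃ s) (H s) (a≢b⇒a-b≢0 a (l ·₃ b) a≢lb)) ⟩
  sum₃ (λ s → sum₃ (H s))  ∎
  where
  c : Fin 3
  c = a +₃ -₃ (l ·₃ b)

∑ : ∀ n → (Vec (Fin 3) n → ℚ) → ℚ
∑ zero    f = f []
∑ (suc n) f = sum₃ (λ k → ∑ n (λ v → f (k ∷ v)))

∑-cong : ∀ n {f g : Vec (Fin 3) n → ℚ} → (∀ x → f x ≡ g x) → ∑ n f ≡ ∑ n g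
∑-cong zero    f≗g = f≗g []
∑-cong (suc n) f≗g = sum₃-cong (λ k → ∑-cong n (λ v → f≗g (k ∷ v)))

∑-+ : ∀ n (f g : Vec (Fin 3) n → ℚ) → ∑ n (λ x → f x + g x) ≡ ∑ n f + ∑ n g
∑-+ zero    f g = refl
∑-+ (suc n) f g = begin
  sum₃ (λ k → ∑ n (λ v → f (k ∷ v) + g (k ∷ v)))
    ≡⟨ sum₃-cong (λ k → ∑-+ n (λ v → f (k ∷ v)) (λ v → g (k ∷ v))) ⟩
  sum₃ (λ k → ∑ n (λ v → f (k ∷ v)) + ∑ n (λ v → g (k ∷ v)))
    ≡⟨ sum₃-+ (λ k → ∑ n (λ v → f (k ∷ v))) (λ k → ∑ n (λ v → g (k ∷ v))) ⟩
  ∑ (suc n) f + ∑ (suc n) g  ∎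

∑-*ˡ : ∀ n p (f : Vec (Fin 3) n → ℚ) → ∑ n (λ x → p * f x) ≡ p * ∑ n f
∑-*ˡ zero    p f = refl
∑-*ˡ (suc n) p f = trans (sum₃-cong (λ k → ∑-*ˡ n p (λ v → f (k ∷ v))))
                         (sum₃-*ˡ p (λ k → ∑ n (λ v → f (k ∷ v))))

∑-const : ∀ n p → ∑ n (λ _ → p) ≡ toℚ 3 ^ n * p
∑-const zero    p = sym (*-identityˡ p)
∑-const (suc n) p = begin
  sum₃ (λ _ → ∑ n (λ _ → p))   ≡⟨ sum₃-cong (λ _ → ∑-const n p) ⟩
  sum₃ (λ _ → toℚ 3 ^ n * p)   ≡⟨ sum₃-const (toℚ 3 ^ n * p) ⟩
  toℚ 3 * (toℚ 3 ^ n * p)      ≡⟨ sym (*-assoc (toℚ 3) (toℚ 3 ^ n) p) ⟩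
  toℚ 3 ^ suc n * p            ∎

∑-zero : ∀ n (f : Vec (Fin 3) n → ℚ) → (∀ x → f x ≡ 0ℚ) → ∑ n f ≡ 0ℚ
∑-zero n f f≡0 = trans (∑-cong n f≡0) (trans (∑-const n 0ℚ) (*-zeroʳ (toℚ 3 ^ n)))

∑-sum₃ : ∀ n (f : Fin 3 → Vec (Fin 3) n → ℚ) →
  ∑ n (λ x → sum₃ (λ k → f k x)) ≡ sum₃ (λ k → ∑ n (f k))
∑-sum₃ n f = trans (∑-+ n (f 0F) (λ x → f 1F x + f 2F x)) (cong (∑ n (f 0F) +_) (∑-+ n (f 1F) (f 2F)))

∑-comm : ∀ n m (f : Vec (Fin 3) n → Vec (Fin 3) m → ℚ) →
  ∑ n (λ x → ∑ m (f x)) ≡ ∑ m (λ a → ∑ n (λ x → f x a))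
∑-comm zero    m f = refl
∑-comm (suc n) m f = trans (sum₃-cong (λ k → ∑-comm n m (λ v → f (k ∷ v))))
                           (sym (∑-sum₃ m (λ k a → ∑ n (λ v → f (k ∷ v) a))))

∑-single : ∀ {n} b (f : Vec (Fin 3) n → ℚ) → (∀ a → a ≢ b → f a ≡ 0ℚ) → ∑ n f ≡ f b
∑-single []           f _   = refl
∑-single {suc n} (b ∷ bs) f f≡0 = begin
  sum₃ (λ k → ∑ n (λ v → f (k ∷ v)))
    ≡⟨ sum₃-single b (λ k → ∑ n (λ v → f (k ∷ v)))
         (λ k k≢b → ∑-zero n (λ v → f (k ∷ v)) (λ v → f≡0 (k ∷ v) (k≢b ∘ ∷-injectiveˡ))) ⟩
  ∑ n (λ v → f (b ∷ v))
    ≡⟨ ∑-single bs (λ v → f (b ∷ v)) (λ v v≢bs → f≡0 (b ∷ v) (v≢bs ∘ ∷-injectiveʳ)) ⟩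
  f (b ∷ bs)  ∎

sumℚ-allVecs : ∀ n (f : Vec (Fin 3) n → ℚ) → sumℚ (map f (allVecs n)) ≡ ∑ n f
sumℚ-allVecs zero    f = +-identityʳ (f [])
sumℚ-allVecs (suc n) f = begin
  sumℚ (map f (allVecs (suc n)))
    ≡⟨ sumℚ-concatMap (allVecs n) ⟩
  sumℚ (map (λ v → sum₃ (λ k → f (k ∷ v))) (allVecs n))
    ≡⟨ sumℚ-allVecs n (λ v → sum₃ (λ k → f (k ∷ v))) ⟩
  ∑ n (λ v → sum₃ (λ k → f (k ∷ v)))
    ≡⟨ ∑-sum₃ n (λ k v → f (k ∷ v)) ⟩
  ∑ (suc n) f  ∎
  where
  sumℚ-concatMap : ∀ vs →
    sumℚ (map f (concatMap (λ v → (0F ∷ v) ∷ (1F ∷ v) ∷ (2F ∷ v) ∷ []) vs))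
      ≡ sumℚ (map (λ v → sum₃ (λ k → f (k ∷ v))) vs)
  sumℚ-concatMap []       = refl
  sumℚ-concatMap (v ∷ vs) = trans
    (solve 4 (λ a b c r → a :+ (b :+ (c :+ r)) := (a :+ (b :+ c)) :+ r) refl
      (f (0F ∷ v)) (f (1F ∷ v)) (f (2F ∷ v))
      (sumℚ (map f (concatMap (λ v → (0F ∷ v) ∷ (1F ∷ v) ∷ (2F ∷ v) ∷ []) vs))))
    (cong (sum₃ (λ k → f (k ∷ v)) +_) (sumℚ-concatMap vs))

≢zeroVec⇒head≢0 : ∀ {n} {b : Fin 3} → b ∷ zeroVec n ≢ zeroVec (suc n) → b ≢ 0F
≢zeroVec⇒head≢0 b≢0 refl = b≢0 refl

∑-∙-uniform : ∀ {n} (b : Vec (Fin 3) n) (G : Fin 3 → ℚ) → b ≢ zeroVec n →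
  toℚ 3 * ∑ n (λ x → G (b ∙ x)) ≡ toℚ 3 ^ n * sum₃ G
∑-∙-uniform []                 G b≢0 = ⊥-elim (b≢0 refl)
∑-∙-uniform {suc n} (b ∷ bs) G b≢0 with ≡-decᵥ _≟_ bs (zeroVec n)
... | yes refl = begin
  toℚ 3 * sum₃ (λ k → ∑ n (λ v → G (zeroVec n ∙ v +₃ b ·₃ k)))
    ≡⟨ cong (toℚ 3 *_) (sum₃-cong λ k →
         trans (∑-cong n (λ v → cong G (zeroVec∙x+c≡c v (b ·₃ k)))) (∑-const n (G (b ·₃ k)))) ⟩
  toℚ 3 * sum₃ (λ k → toℚ 3 ^ n * G (b ·₃ k))
    ≡⟨ cong (toℚ 3 *_) (sum₃-*ˡ (toℚ 3 ^ n) (λ k → G (b ·₃ k))) ⟩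
  toℚ 3 * (toℚ 3 ^ n * sum₃ (λ k → G (b ·₃ k)))
    ≡⟨ sym (*-assoc (toℚ 3) (toℚ 3 ^ n) _) ⟩
  toℚ 3 ^ suc n * sum₃ (λ k → G (b ·₃ k))
    ≡⟨ cong (toℚ 3 ^ suc n *_) (sum₃-scale G (≢zeroVec⇒head≢0 b≢0)) ⟩
  toℚ 3 ^ suc n * sum₃ G  ∎
... | no bs≢0 = begin
  toℚ 3 * sum₃ (λ k → ∑ n (λ v → G (bs ∙ v +₃ b ·₃ k)))
    ≡⟨ sum₃-scaled (toℚ 3) (toℚ 3 ^ n) (λ k → ∑ n (λ v → G (bs ∙ v +₃ b ·₃ k))) (λ _ → sum₃ G)
         (λ k → trans (∑-∙-uniform bs (λ t → G (t +₃ b ·₃ k)) bs≢0)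
                      (cong (toℚ 3 ^ n *_) (sum₃-translate (b ·₃ k) G))) ⟩
  toℚ 3 ^ n * sum₃ (λ _ → sum₃ G)
    ≡⟨ cong (toℚ 3 ^ n *_) (sum₃-const (sum₃ G)) ⟩
  toℚ 3 ^ n * (toℚ 3 * sum₃ G)
    ≡⟨ solve 3 (λ p q s → p :* (q :* s) := (q :* p) :* s) refl (toℚ 3 ^ n) (toℚ 3) (sum₃ G) ⟩
  toℚ 3 ^ suc n * sum₃ G  ∎

∑-∙-multiple : ∀ {n} (b : Vec (Fin 3) n) l (H : Fin 3 → Fin 3 → ℚ) → b ≢ zeroVec n →
  toℚ 3 * ∑ n (λ x → H (b ∙ x) ((l • b) ∙ x)) ≡ toℚ 3 ^ n * sum₃ (λ t → H t (l ·₃ t))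
∑-∙-multiple {n} b l H b≢0 = trans
  (cong (toℚ 3 *_) (∑-cong n (λ x → cong (H (b ∙ x)) (∙-•ˡ l b x))))
  (∑-∙-uniform b (λ t → H t (l ·₃ t)) b≢0)

∑-∙-independent : ∀ {n} (a b : Vec (Fin 3) n) (H : Fin 3 → Fin 3 → ℚ) →
  b ≢ zeroVec n → (∀ l → a ≢ l • b) →
  toℚ 9 * ∑ n (λ x → H (b ∙ x) (a ∙ x)) ≡ toℚ 3 ^ n * sum₃ (λ s → sum₃ (H s))
∑-∙-independent []       []       H b≢0 _ = ⊥-elim (b≢0 refl)
∑-∙-independent {suc n} (a ∷ as) (b ∷ bs) H b≢0 a∉⟨b⟩
  with ≡-decᵥ _≟_ bs (zeroVec n) | any? (λ l → ≡-decᵥ _≟_ as (l • bs))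
... | yes refl | _ = begin
  toℚ 9 * sum₃ X
    ≡⟨ *-assoc (toℚ 3) (toℚ 3) (sum₃ X) ⟩
  toℚ 3 * (toℚ 3 * sum₃ X)
    ≡⟨ cong (toℚ 3 *_) (sum₃-scaled (toℚ 3) (toℚ 3 ^ n) X (λ k → sum₃ (H (b ·₃ k))) 3X≡) ⟩
  toℚ 3 * (toℚ 3 ^ n * sum₃ (λ k → sum₃ (H (b ·₃ k))))
    ≡⟨ sym (*-assoc (toℚ 3) (toℚ 3 ^ n) _) ⟩
  toℚ 3 ^ suc n * sum₃ (λ k → sum₃ (H (b ·₃ k)))
    ≡⟨ cong (toℚ 3 ^ suc n *_) (sum₃-scale (λ s → sum₃ (H s)) b≢0F) ⟩
  toℚ 3 ^ suc n * sum₃ (λ s → sum₃ (H s))  ∎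
  where
  X : Fin 3 → ℚ
  X k = ∑ n (λ v → H (zeroVec n ∙ v +₃ b ·₃ k) (as ∙ v +₃ a ·₃ k))
  b≢0F : b ≢ 0F
  b≢0F = ≢zeroVec⇒head≢0 b≢0
  as≢0 : as ≢ zeroVec n
  as≢0 refl = a∉⟨b⟩ (a ·₃ b) (cong₂ _∷_ (sym (a·b·b≡a a b b≢0F)) (sym (•-zeroʳ n (a ·₃ b))))
  3X≡ : ∀ k → toℚ 3 * X k ≡ toℚ 3 ^ n * sum₃ (H (b ·₃ k))
  3X≡ k = begin
    toℚ 3 * X k
      ≡⟨ cong (toℚ 3 *_) (∑-cong n (λ v → cong (λ s → H s (as ∙ v +₃ a ·₃ k)) (zeroVec∙x+c≡c v (b ·₃ k)))) ⟩
    toℚ 3 * ∑ n (λ v → H (b ·₃ k) (as ∙ v +₃ a ·₃ k))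
      ≡⟨ ∑-∙-uniform as (λ t → H (b ·₃ k) (t +₃ a ·₃ k)) as≢0 ⟩
    toℚ 3 ^ n * sum₃ (λ t → H (b ·₃ k) (t +₃ a ·₃ k))
      ≡⟨ cong (toℚ 3 ^ n *_) (sum₃-translate (a ·₃ k) (H (b ·₃ k))) ⟩
    toℚ 3 ^ n * sum₃ (H (b ·₃ k))  ∎
... | no bs≢0 | yes (l , refl) = begin
  toℚ 9 * sum₃ X
    ≡⟨ *-assoc (toℚ 3) (toℚ 3) (sum₃ X) ⟩
  toℚ 3 * (toℚ 3 * sum₃ X)
    ≡⟨ cong (toℚ 3 *_) (sum₃-scaled (toℚ 3) (toℚ 3 ^ n) X Y
         (λ k → ∑-∙-multiple bs l (λ s t → H (s +₃ b ·₃ k) (t +₃ a ·₃ k)) bs≢0)) ⟩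
  toℚ 3 * (toℚ 3 ^ n * sum₃ Y)
    ≡⟨ sym (*-assoc (toℚ 3) (toℚ 3 ^ n) _) ⟩
  toℚ 3 ^ suc n * sum₃ Y
    ≡⟨ cong (toℚ 3 ^ suc n *_) (sum₃-shear l a b H (λ a≡lb → a∉⟨b⟩ l (cong (_∷ l • bs) a≡lb))) ⟩
  toℚ 3 ^ suc n * sum₃ (λ s → sum₃ (H s))  ∎
  where
  X Y : Fin 3 → ℚ
  X k = ∑ n (λ v → H (bs ∙ v +₃ b ·₃ k) ((l • bs) ∙ v +₃ a ·₃ k))
  Y k = sum₃ (λ t → H (t +₃ b ·₃ k) (l ·₃ t +₃ a ·₃ k))
... | no bs≢0 | no as∉⟨bs⟩ = begin
  toℚ 9 * sum₃ X
    ≡⟨ sum₃-scaled (toℚ 9) (toℚ 3 ^ n) X (λ _ → S) 9X≡ ⟩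
  toℚ 3 ^ n * sum₃ (λ _ → S)
    ≡⟨ cong (toℚ 3 ^ n *_) (sum₃-const S) ⟩
  toℚ 3 ^ n * (toℚ 3 * S)
    ≡⟨ solve 3 (λ p q s → p :* (q :* s) := (q :* p) :* s) refl (toℚ 3 ^ n) (toℚ 3) S ⟩
  toℚ 3 ^ suc n * S  ∎
  where
  X : Fin 3 → ℚ
  X k = ∑ n (λ v → H (bs ∙ v +₃ b ·₃ k) (as ∙ v +₃ a ·₃ k))
  S : ℚ
  S = sum₃ (λ s → sum₃ (H s))
  9X≡ : ∀ k → toℚ 9 * X k ≡ toℚ 3 ^ n * S
  9X≡ k = begin
    toℚ 9 * X k
      ≡⟨ ∑-∙-independent as bs (λ s t → H (s +₃ b ·₃ k) (t +₃ a ·₃ k)) bs≢0 (λ l eq → as∉⟨bs⟩ (l , eq)) ⟩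
    toℚ 3 ^ n * sum₃ (λ s → sum₃ (λ t → H (s +₃ b ·₃ k) (t +₃ a ·₃ k)))
      ≡⟨ cong (toℚ 3 ^ n *_) (trans (sum₃-cong (λ s → sum₃-translate (a ·₃ k) (H (s +₃ b ·₃ k))))
                                    (sum₃-translate (b ·₃ k) (λ s → sum₃ (H s)))) ⟩
    toℚ 3 ^ n * S  ∎

*-cancelˡ-≡0 : ∀ p {q} → p ≢ 0ℚ → p * q ≡ 0ℚ → q ≡ 0ℚ
*-cancelˡ-≡0 p {q} p≢0 pq≡0 = begin
  q                 ≡⟨ sym (*-identityˡ q) ⟩
  1ℚ * q            ≡⟨ cong (_* q) (sym (*-inverseˡ p)) ⟩
  1/ p * p * q      ≡⟨ *-assoc (1/ p) p q ⟩
  1/ p * (p * q)    ≡⟨ cong (1/ p *_) pq≡0 ⟩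
  1/ p * 0ℚ         ≡⟨ *-zeroʳ (1/ p) ⟩
  0ℚ                ∎
  where instance _ = ≢-nonZero p≢0

3^n≢0 : ∀ n → toℚ 3 ^ n ≢ 0ℚ
3^n≢0 zero    ()
3^n≢0 (suc n) eq = 3^n≢0 n (*-cancelˡ-≡0 (toℚ 3) (λ ()) eq)

asℚ : Fin 3 → ℚ
asℚ t = toℚ (toℕ t)

-- Zero-sum weights, orthogonal to t ↦ asℚ (2 t) but not to t ↦ asℚ t.
ω : Fin 3 → ℚ
ω 0F = 1ℚ
ω 1F = 1ℚ
ω 2F = - toℚ 2

correlation : ∀ {n} → Vec (Fin 3) n → Vec (Fin 3) n → ℚ
correlation {n} b a = ∑ n (λ x → ω (b ∙ x) * asℚ (a ∙ x))

correlation-self≢0 : ∀ {n} (b : Vec (Fin 3) n) → b ≢ zeroVec n → correlation b b ≢ 0ℚ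
correlation-self≢0 {n} b b≢0 corr≡0 = -3≢0 (*-cancelˡ-≡0 (toℚ 3 ^ n) (3^n≢0 n) (begin
  toℚ 3 ^ n * - toℚ 3             ≡⟨ sym (∑-∙-multiple b 1F (λ s t → ω s * asℚ t) b≢0) ⟩
  toℚ 3 * correlation b (1F • b)  ≡⟨ cong (λ a → toℚ 3 * correlation b a) (•-identityˡ b) ⟩
  toℚ 3 * correlation b b         ≡⟨ cong (toℚ 3 *_) corr≡0 ⟩
  0ℚ                              ∎))
  where
  -3≢0 : - toℚ 3 ≢ 0ℚ
  -3≢0 ()

correlation-other : ∀ {n} (b a : Vec (Fin 3) n) → b ≢ zeroVec n → a ≢ b → correlation b a ≡ 0ℚ
correlation-other {n} b a b≢0 a≢b with any? (λ l → ≡-decᵥ _≟_ a (l • b))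
... | yes (0F , refl) = *-cancelˡ-≡0 (toℚ 3) (λ ())
  (trans (∑-∙-multiple b 0F (λ s t → ω s * asℚ t) b≢0) (*-zeroʳ (toℚ 3 ^ n)))
... | yes (1F , refl) = ⊥-elim (a≢b (•-identityˡ b))
... | yes (2F , refl) = *-cancelˡ-≡0 (toℚ 3) (λ ())
  (trans (∑-∙-multiple b 2F (λ s t → ω s * asℚ t) b≢0) (*-zeroʳ (toℚ 3 ^ n)))
... | no a∉⟨b⟩ = *-cancelˡ-≡0 (toℚ 9) (λ ())
  (trans (∑-∙-independent a b (λ s t → ω s * asℚ t) b≢0 (λ l eq → a∉⟨b⟩ (l , eq)))
         (*-zeroʳ (toℚ 3 ^ n)))

coefficient≡0 : ∀ {n} (c : Vec (Fin 3) n → ℚ) → (∀ x → ∑ n (λ a → c a * asℚ (a ∙ x)) ≡ 0ℚ) →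
  ∀ b → b ≢ zeroVec n → c b ≡ 0ℚ
coefficient≡0 {n} c sums≡0 b b≢0 = *-cancelˡ-≡0 (correlation b b) (correlation-self≢0 b b≢0) (begin
  correlation b b * c b
    ≡⟨ *-comm (correlation b b) (c b) ⟩
  c b * correlation b b
    ≡⟨ sym (∑-single b (λ a → c a * correlation b a)
         (λ a a≢b → trans (cong (c a *_) (correlation-other b a b≢0 a≢b)) (*-zeroʳ (c a)))) ⟩
  ∑ n (λ a → c a * correlation b a)
    ≡⟨ ∑-cong n (λ a → trans (sym (∑-*ˡ n (c a) _))
                              (∑-cong n (λ x → *-exchange (c a) (ω (b ∙ x)) (asℚ (a ∙ x))))) ⟩
  ∑ n (λ a → ∑ n (λ x → ω (b ∙ x) * (c a * asℚ (a ∙ x))))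
    ≡⟨ sym (∑-comm n n (λ x a → ω (b ∙ x) * (c a * asℚ (a ∙ x)))) ⟩
  ∑ n (λ x → ∑ n (λ a → ω (b ∙ x) * (c a * asℚ (a ∙ x))))
    ≡⟨ ∑-cong n (λ x → ∑-*ˡ n (ω (b ∙ x)) (λ a → c a * asℚ (a ∙ x))) ⟩
  ∑ n (λ x → ω (b ∙ x) * ∑ n (λ a → c a * asℚ (a ∙ x)))
    ≡⟨ ∑-zero n _ (λ x → trans (cong (ω (b ∙ x) *_) (sums≡0 x)) (*-zeroʳ (ω (b ∙ x)))) ⟩
  0ℚ  ∎)
  where
  *-exchange : ∀ p q r → p * (q * r) ≡ q * (p * r)
  *-exchange = solve 3 (λ p q r → p :* (q :* r) := q :* (p :* r)) refl

lemma6p17 : (n : ℕ) → n ≥ 1 → (c : Vec (Fin 3) n → ℚ) →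
    ((x : Vec (Fin 3) n) → sumℚ (map (λ a → c a * toℚ (C n x a)) (allVecs n)) ≡ 0ℚ) →
    (a : Vec (Fin 3) n) → a ≢ zeroVec n → c a ≡ 0ℚ
lemma6p17 n _ c sums≡0 = coefficient≡0 c (λ x → begin
  ∑ n (λ a → c a * asℚ (a ∙ x))
    ≡⟨ ∑-cong n (λ a → cong (λ m → c a * toℚ m) (sym (C≡toℕ-∙ n x a))) ⟩
  ∑ n (λ a → c a * toℚ (C n x a))
    ≡⟨ sym (sumℚ-allVecs n (λ a → c a * toℚ (C n x a))) ⟩
  sumℚ (map (λ a → c a * toℚ (C n x a)) (allVecs n))
    ≡⟨ sums≡0 x ⟩
  0ℚ  ∎)
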